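{- Let $\mathbf a=(a_n)_{n\ge1}$ be a strong divisibility sequence. Then for every integer $n\ge 0$, $$\operatorname{lcm}\left\{\binom{n}{0}_{\mathbf a},\binom{n}{1}_{\mathbf a},\dots,\binom{n}{n}_{\mathbf a}\right\}=\frac{\operatorname{lcm}(a_1,a_2,\dots,a_n,a_{n+1})}{a_{n+1}}.$$
   Context: A sequence $(a_n)_{n\ge1}$ of positive integers is a strong divisibility sequence if $\gcd(a_n,a_m)=a_{\gcd(n,m)}$ for all positive integers $n,m$. For $n\in\mathbb{N}$ set $[n]_{\mathbf a}!:=a_1a_2\cdots a_n$ (with $[0]_{\mathbf a}!=1$), and for integers $0\le k\le n$ define the $\mathbf a$-binomial coefficient $\binom{n}{k}_{\mathbf a}:=\frac{[n]_{\mathbf a}!}{[k]_{\mathbf a}!\,[n-k]_{\mathbf a}!}=\frac{a_na_{n-1}\cdots a_{n-k+1}}{a_1a_2\cdots a_k}$ (these are positive integers for a strong divisibility sequence). -}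

module Defs where

open import Data.Nat using (ℕ; zero; suc; _*_; _∸_; _≤_; _<_; NonZero; >-nonZero; s≤s; z≤n)
open import Data.Nat.Properties using (m*n≢0)
open import Data.Nat.DivMod using (_/_)
open import Data.Nat.GCD using (gcd)
open import Data.Nat.LCM using (lcm)
open import Data.List using (List; []; _∷_; foldr; map; upTo)
open import Data.Product using (_×_; proj₁)
open import Relation.Binary.PropositionalEquality using (_≡_)

-- A sequence (a_n)_{n≥1} is modelled as a : ℕ → ℕ; the value a 0 is irrelevant.

IsPositiveSeq : (ℕ → ℕ) → Set
IsPositiveSeq a = ∀ n → 1 ≤ n → 0 < a n

IsStrongDivSeq : (ℕ → ℕ) → Set
IsStrongDivSeq a =
  IsPositiveSeq a × (∀ n m → 1 ≤ n → 1 ≤ m → gcd (a n) (a m) ≡ a (gcd n m))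

seqFact : (ℕ → ℕ) → ℕ → ℕ
seqFact a zero    = 1
seqFact a (suc n) = seqFact a n * a (suc n)

seqFact-nonZero : (a : ℕ → ℕ) → IsPositiveSeq a → ∀ m → NonZero (seqFact a m)
seqFact-nonZero a pos zero    = _
seqFact-nonZero a pos (suc m) =
  m*n≢0 (seqFact a m) (a (suc m))
    {{seqFact-nonZero a pos m}} {{>-nonZero (pos (suc m) (s≤s z≤n))}}

-- the a-binomial coefficient  [n]_a! / ([k]_a! [n-k]_a!)   (used for 0 ≤ k ≤ n)
seqBinom : (a : ℕ → ℕ) → IsPositiveSeq a → ℕ → ℕ → ℕ
seqBinom a pos n k =
  (seqFact a n / (seqFact a k * seqFact a (n ∸ k)))
    {{m*n≢0 (seqFact a k) (seqFact a (n ∸ k))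
       {{seqFact-nonZero a pos k}} {{seqFact-nonZero a pos (n ∸ k)}}}}

lcmList : List ℕ → ℕ
lcmList = foldr lcm 1

oneTo : ℕ → List ℕ
oneTo n = map suc (upTo n)

-- Fix a prime p and put f j = v_p(a_j). Strong divisibility makes f send gcd to min, so each
-- level set {j ≥ 1 | f j ≥ t} is the set of multiples of some r_t, and
-- v_p([m]_a!) = f 1 + ⋯ + f m = Σ_t ⌊m/r_t⌋. As ⌊k/r⌋ + ⌊m/r⌋ ≤ ⌊(k+m)/r⌋ and
-- ⌊(k+m+1)/r⌋ ≤ ⌊k/r⌋ + ⌊m/r⌋ + 1, this gives [k]_a! [m]_a! ∣ [k+m]_a!, and also
-- [k+m+1]_a! ∣ L [k]_a! [m]_a! whenever L is a common multiple of a_1, …, a_{k+m+1}, because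
-- then at most v_p(L) levels meet [1, k+m+1]. With k + m = n, the first shows that a_{k+1}
-- divides (n choose k)_a a_{n+1} and the second that (n choose k)_a a_{n+1} divides
-- lcm(a_1, …, a_{n+1}); so the two sides of the identity divide each other.
module Submission where

open import Data.Bool.Base using (if_then_else_)
open import Data.List.Base using ([]; _∷_; map; upTo)
open import Data.List.Membership.Propositional using (_∈_)
open import Data.List.Membership.Propositional.Properties using (∈-map⁺; ∈-map⁻; ∈-upTo⁺; ∈-upTo⁻)
open import Data.List.Relation.Unary.All using (_∷_)
open import Data.List.Relation.Unary.Any using (here; there)
open import Data.Nat
open import Data.Nat.Properties
open import Data.Nat.Divisibility
open import Data.Nat.DivMod using (m/n*n≡m)
open import Data.Nat.GCD
open import Data.Nat.LCM
open import Data.Nat.Primality using (Prime; prime⇒nonZero; prime⇒nonTrivial; euclidsLemma)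
open import Data.Nat.Primality.Factorisation using (factorise)
open import Data.Product using (∃-syntax; _×_; _,_; proj₁; proj₂)
open import Data.Sum using (inj₁; inj₂; [_,_]′)
open import Function using (_∘_)
open import Relation.Binary using (_Preserves_⟶_)
open import Relation.Binary.PropositionalEquality
open import Relation.Nullary using (¬_; yes; no; does; contradiction)
open import Defs

open import Algebra.Properties.CommutativeSemigroup +-commutativeSemigroup using (interchange)
import Algebra.Properties.CommutativeSemigroup *-commutativeSemigroup as *-CS

partialSum : (ℕ → ℕ) → ℕ → ℕ
partialSum f zero    = 0
partialSum f (suc m) = partialSum f m + f (suc m)

partialSum-+ : ∀ f g m → partialSum (λ j → f j + g j) m ≡ partialSum f m + partialSum g m
partialSum-+ f g zero    = refl
partialSum-+ f g (suc m) = trans (cong (_+ (f (suc m) + g (suc m))) (partialSum-+ f g m))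
  (interchange (partialSum f m) (partialSum g m) (f (suc m)) (g (suc m)))

partialSum-cong : ∀ {f g} m → (∀ {j} → 1 ≤ j → j ≤ m → f j ≡ g j) →
                  partialSum f m ≡ partialSum g m
partialSum-cong zero    f≡g = refl
partialSum-cong (suc m) f≡g =
  cong₂ _+_ (partialSum-cong m (λ 1≤j j≤m → f≡g 1≤j (m≤n⇒m≤1+n j≤m))) (f≡g z<s ≤-refl)

partialSum-zero : ∀ {f} m → (∀ {j} → 1 ≤ j → j ≤ m → f j ≡ 0) → partialSum f m ≡ 0
partialSum-zero zero    f≡0 = refl
partialSum-zero (suc m) f≡0 =
  cong₂ _+_ (partialSum-zero m (λ 1≤j j≤m → f≡0 1≤j (m≤n⇒m≤1+n j≤m))) (f≡0 z<s ≤-refl)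

≤partialSum : ∀ f {j} m → 1 ≤ j → j ≤ m → f j ≤ partialSum f m
≤partialSum f zero    (s≤s _) ()
≤partialSum f (suc m) 1≤j j≤1+m with m≤n⇒m<n∨m≡n j≤1+m
... | inj₁ j<1+m = ≤-trans (≤partialSum f m 1≤j (m<1+n⇒m≤n j<1+m)) (m≤m+n _ _)
... | inj₂ refl  = m≤n+m _ _

floor-superadditive : ∀ r {q₁ q₂ q k m} →
  q₁ * r ≤ k → q₂ * r ≤ m → k + m < suc q * r → q₁ + q₂ ≤ q
floor-superadditive r {q₁} {q₂} {q} q₁r≤k q₂r≤m k+m<[1+q]r = m<1+n⇒m≤n
  (*-cancelʳ-< r (q₁ + q₂) (suc q)
    (≤-<-trans (≤-reflexive (*-distribʳ-+ r q₁ q₂))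
               (≤-<-trans (+-mono-≤ q₁r≤k q₂r≤m) k+m<[1+q]r)))

floor-subadditive : ∀ r {q₁ q₂ q k m} →
  k < suc q₁ * r → m < suc q₂ * r → q * r ≤ suc (k + m) → q ≤ q₁ + q₂ + 1
floor-subadditive r {q₁} {q₂} {q} {k} {m} k<[1+q₁]r m<[1+q₂]r qr≤1+k+m =
  subst (q ≤_) (+-comm 1 (q₁ + q₂)) (m<1+n⇒m≤n (*-cancelʳ-< r q (suc (suc (q₁ + q₂))) (begin-strict
    q * r                     ≤⟨ qr≤1+k+m ⟩
    suc (k + m)               <⟨ ≤-trans (≤-reflexive (cong suc (sym (+-suc k m))))
                                         (+-mono-≤ k<[1+q₁]r m<[1+q₂]r) ⟩
    suc q₁ * r + suc q₂ * r   ≡⟨ *-distribʳ-+ r (suc q₁) (suc q₂) ⟨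
    (suc q₁ + suc q₂) * r     ≡⟨ cong (λ s → suc s * r) (+-suc q₁ q₂) ⟩
    suc (suc (q₁ + q₂)) * r   ∎)))
  where open ≤-Reasoning

divIndicator : ℕ → ℕ → ℕ
divIndicator r j = if does (r ∣? j) then 1 else 0

divIndicator-0 : ∀ {j} → 1 ≤ j → divIndicator 0 j ≡ 0
divIndicator-0 {j} 1≤j with 0 ∣? j
... | yes 0∣j = contradiction (0∣⇒≡0 0∣j) (m<n⇒n≢0 1≤j)
... | no  _   = refl

next-multiple : ∀ r .{{_ : NonZero r}} {c m} → c * r ≤ m → m < suc c * r → r ∣ suc m →
                suc m ≡ suc c * r
next-multiple r {c} {m} cr≤m m<[1+c]r (divides q 1+m≡qr) =
  trans 1+m≡qr (cong (_* r) (≤-antisym q≤1+c c<q))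
  where
  c<q : c < q
  c<q = *-cancelʳ-< r c q (≤-<-trans cr≤m (≤-reflexive 1+m≡qr))
  q≤1+c : q ≤ suc c
  q≤1+c = *-cancelʳ-≤ q (suc c) r (≤-trans (≤-reflexive (sym 1+m≡qr)) m<[1+c]r)

multiples-floor : ∀ r .{{_ : NonZero r}} m →
  let c = partialSum (divIndicator r) m in c * r ≤ m × m < suc c * r
multiples-floor r zero = z≤n , ≤-trans (>-nonZero⁻¹ r) (m≤m+n r 0)
multiples-floor r (suc m) with multiples-floor r m | r ∣? suc m
... | cr≤m , m<[1+c]r | yes r∣1+m =
  subst (λ c′ → c′ * r ≤ suc m × suc m < suc c′ * r) (+-comm 1 c)
    (≤-reflexive (sym 1+m≡[1+c]r) ,
     ≤-trans (≤-reflexive (cong suc 1+m≡[1+c]r)) (+-monoˡ-≤ _ (>-nonZero⁻¹ r)))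
  where
  c = partialSum (divIndicator r) m
  1+m≡[1+c]r : suc m ≡ suc c * r
  1+m≡[1+c]r = next-multiple r {c} cr≤m m<[1+c]r r∣1+m
... | cr≤m , m<[1+c]r | no ¬r∣1+m =
  subst (λ c′ → c′ * r ≤ suc m × suc m < suc c′ * r) (sym (+-identityʳ c))
    (m≤n⇒m≤1+n cr≤m ,
     ≤∧≢⇒< m<[1+c]r (λ 1+m≡[1+c]r → ¬r∣1+m (divides (suc c) 1+m≡[1+c]r)))
  where
  c = partialSum (divIndicator r) m

record PartialSumBounds (f : ℕ → ℕ) (k m B : ℕ) : Set where
  field
    superadditive : partialSum f k + partialSum f m ≤ partialSum f (k + m)
    subadditive   : partialSum f (suc (k + m)) ≤ partialSum f k + partialSum f m + B

open PartialSumBounds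

zero-bounds : ∀ k m B → PartialSumBounds (λ _ → 0) k m B
zero-bounds k m B = record
  { superadditive = ≤-reflexive (trans (cong₂ _+_ (none k) (none m)) (sym (none (k + m))))
  ; subadditive   = subst (_≤ partialSum (λ _ → 0) k + partialSum (λ _ → 0) m + B)
                      (sym (none (suc (k + m)))) z≤n
  }
  where
  none : ∀ n → partialSum (λ _ → 0) n ≡ 0
  none n = partialSum-zero n (λ _ _ → refl)

module _ {k m : ℕ} where

  bounds-cong : ∀ {f g B} → (∀ {j} → 1 ≤ j → j ≤ suc (k + m) → f j ≡ g j) →
                PartialSumBounds f k m B → PartialSumBounds g k m B
  bounds-cong {f} {g} {B} f≡g f-bounds = record
    { superadditive = subst₂ _≤_ pair (sums (n≤1+n _)) (superadditive f-bounds)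
    ; subadditive   = subst₂ _≤_ (sums ≤-refl) (cong (_+ B) pair) (subadditive f-bounds)
    }
    where
    sums : ∀ {n} → n ≤ suc (k + m) → partialSum f n ≡ partialSum g n
    sums n≤ = partialSum-cong _ (λ 1≤j j≤n → f≡g 1≤j (≤-trans j≤n n≤))
    pair : partialSum f k + partialSum f m ≡ partialSum g k + partialSum g m
    pair = cong₂ _+_ (sums (≤-trans (m≤m+n k m) (n≤1+n _))) (sums (≤-trans (m≤n+m m k) (n≤1+n _)))

  bounds-+ : ∀ {f g B C} → PartialSumBounds f k m B → PartialSumBounds g k m C →
             PartialSumBounds (λ j → f j + g j) k m (B + C)
  bounds-+ {f} {g} {B} {C} f-bounds g-bounds = record
    { superadditive = subst₂ _≤_ (sym pair) (sym (partialSum-+ f g (k + m)))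
                        (+-mono-≤ (superadditive f-bounds) (superadditive g-bounds))
    ; subadditive   = subst₂ _≤_ (sym (partialSum-+ f g (suc (k + m))))
                        (sym (trans (cong (_+ (B + C)) pair)
                          (interchange (partialSum f k + partialSum f m) (partialSum g k + partialSum g m) B C)))
                        (+-mono-≤ (subadditive f-bounds) (subadditive g-bounds))
    }
    where
    pair : partialSum (λ j → f j + g j) k + partialSum (λ j → f j + g j) m
         ≡ (partialSum f k + partialSum f m) + (partialSum g k + partialSum g m)
    pair = trans (cong₂ _+_ (partialSum-+ f g k) (partialSum-+ f g m))
                 (interchange (partialSum f k) (partialSum g k) (partialSum f m) (partialSum g m))

multiples-bounds : ∀ r k m → PartialSumBounds (divIndicator r) k m 1
multiples-bounds zero k m =
  bounds-cong (λ 1≤j _ → sym (divIndicator-0 1≤j)) (zero-bounds k m 1)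
multiples-bounds r@(suc _) k m = record
  { superadditive = floor-superadditive r {c k} {c m}
                      (proj₁ (floors k)) (proj₁ (floors m)) (proj₂ (floors (k + m)))
  ; subadditive   = floor-subadditive r {c k} {c m}
                      (proj₂ (floors k)) (proj₂ (floors m)) (proj₁ (floors (suc (k + m))))
  }
  where
  c = partialSum (divIndicator r)
  floors = multiples-floor r

GcdToMin : (ℕ → ℕ) → Set
GcdToMin f = ∀ {i j} → 1 ≤ i → 1 ≤ j → f (gcd i j) ≡ f i ⊓ f j

gcdToMin-∘ : ∀ {h f} → h Preserves _≤_ ⟶ _≤_ → GcdToMin f → GcdToMin (h ∘ f)
gcdToMin-∘ {h} h-mono f-min 1≤i 1≤j = trans (cong h (f-min 1≤i 1≤j)) (mono-≤-distrib-⊓ h-mono _ _)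

gcdToMin-mono : ∀ {f i j} → GcdToMin f → 1 ≤ j → i ∣ j → f i ≤ f j
gcdToMin-mono {f} {i} {j} f-min 1≤j i∣j = begin
  f i          ≡⟨ cong f gcd[i,j]≡i ⟨
  f (gcd i j)  ≡⟨ f-min 1≤i 1≤j ⟩
  f i ⊓ f j    ≤⟨ m⊓n≤n (f i) (f j) ⟩
  f j          ∎
  where
  open ≤-Reasoning
  gcd[i,j]≡i : gcd i j ≡ i
  gcd[i,j]≡i = ∣-antisym (gcd[m,n]∣m i j) (gcd-greatest ∣-refl i∣j)
  1≤i : 1 ≤ i
  1≤i = n≢0⇒n>0 (λ { refl → m<n⇒n≢0 1≤j (0∣⇒≡0 i∣j) })

-- For 0/1-valued g, the gcd of those j ≤ N with g j ≡ 1 (and 0 if there are none).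
period : (ℕ → ℕ) → ℕ → ℕ
period g zero    = 0
period g (suc N) = gcd (period g N) (g (suc N) * suc N)

period∣ : ∀ g N {j} → 1 ≤ j → j ≤ N → period g N ∣ g j * j
period∣ g zero    (s≤s _) ()
period∣ g (suc N) 1≤j j≤1+N with m≤n⇒m<n∨m≡n j≤1+N
... | inj₁ j<1+N = ∣-trans (gcd[m,n]∣m (period g N) _) (period∣ g N 1≤j (m<1+n⇒m≤n j<1+N))
... | inj₂ refl  = gcd[m,n]∣n (period g N) _

module _ {g : ℕ → ℕ} (g-min : GcdToMin g) (g≤1 : ∀ j → g j ≤ 1) where

  g[period]≡1 : ∀ N → period g N ≢ 0 → g (period g N) ≡ 1
  g[period]≡1 zero    0≢0 = contradiction refl 0≢0
  g[period]≡1 (suc N) r′≢0 with g (suc N) in g[1+N]≡ | g≤1 (suc N)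
  ... | 0    | _ rewrite gcd-identityʳ (period g N) = g[period]≡1 N r′≢0
  ... | 2+ _ | s≤s ()
  ... | 1    | _ rewrite +-identityʳ N with period g N ≟ 0
  ...   | yes r≡0 rewrite r≡0 | gcd-identityˡ (suc N) = g[1+N]≡
  ...   | no  r≢0 = trans (g-min (n≢0⇒n>0 r≢0) z<s) (cong₂ _⊓_ (g[period]≡1 N r≢0) g[1+N]≡)

  gcdToMin≤1-indicator : ∀ N {j} → 1 ≤ j → j ≤ N → g j ≡ divIndicator (period g N) j
  gcdToMin≤1-indicator N {j} 1≤j j≤N with period g N ∣? j
  ... | yes r∣j = ≤-antisym (g≤1 j)
    (≤-trans (≤-reflexive (sym (g[period]≡1 N r≢0))) (gcdToMin-mono g-min 1≤j r∣j))
    where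
    r≢0 : period g N ≢ 0
    r≢0 r≡0 = m<n⇒n≢0 1≤j (0∣⇒≡0 (subst (_∣ j) r≡0 r∣j))
  ... | no  r∤j with n≤1⇒n≡0∨n≡1 (g≤1 j)
  ...   | inj₁ g[j]≡0 = g[j]≡0
  ...   | inj₂ g[j]≡1 = contradiction
    (∣-trans (period∣ g N 1≤j j≤N) (∣-reflexive (trans (cong (_* j) g[j]≡1) (*-identityˡ j)))) r∤j

-- Peel off the bottom layer f = (1 ⊓ f) + (f ∸ 1): the layer 1 ⊓ f is the indicator of the
-- multiples of its period, whose partial sums are floors, so it costs 1 in the bound.
gcdToMin-bounds : ∀ {f} → GcdToMin f → ∀ k m B →
                  (∀ {j} → 1 ≤ j → j ≤ suc (k + m) → f j ≤ B) → PartialSumBounds f k m B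
gcdToMin-bounds {f} f-min k m zero    f≤0 =
  bounds-cong (λ 1≤j j≤ → sym (n≤0⇒n≡0 (f≤0 1≤j j≤))) (zero-bounds k m 0)
gcdToMin-bounds {f} f-min k m (suc B) f≤1+B =
  bounds-cong (λ {j} _ _ → m⊓n+n∸m≡n 1 (f j)) (bounds-+ bottom-bounds rest-bounds)
  where
  bottom : ℕ → ℕ
  bottom j = 1 ⊓ f j
  bottom-bounds : PartialSumBounds bottom k m 1
  bottom-bounds = bounds-cong
    (λ 1≤j j≤ → sym (gcdToMin≤1-indicator bottom-min (λ j → m⊓n≤m 1 (f j)) _ 1≤j j≤))
    (multiples-bounds (period bottom (suc (k + m))) k m)
    where
    bottom-min : GcdToMin bottom
    bottom-min = gcdToMin-∘ (⊓-monoʳ-≤ 1) f-min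
  rest-bounds : PartialSumBounds (λ j → f j ∸ 1) k m B
  rest-bounds = gcdToMin-bounds (gcdToMin-∘ (∸-monoˡ-≤ 1) f-min) k m B
    (λ 1≤j j≤ → ∸-monoˡ-≤ 1 (f≤1+B 1≤j j≤))

gcdToMin-superadditive : ∀ {f} → GcdToMin f → ∀ k m →
                         partialSum f k + partialSum f m ≤ partialSum f (k + m)
gcdToMin-superadditive {f} f-min k m = superadditive
  (gcdToMin-bounds f-min k m (partialSum f (suc (k + m))) (≤partialSum f (suc (k + m))))

-- Fuel n bounds the number of divisions by p; n = x suffices since p > 1.
valuationWithin : ℕ → ℕ → ℕ → ℕ
valuationWithin zero    p x = 0
valuationWithin (suc n) p x with p ∣? x
... | yes p∣x = suc (valuationWithin n p (quotient p∣x))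
... | no  _   = 0

valuation : ℕ → ℕ → ℕ
valuation p x = valuationWithin x p x

record ExactPower (p e x : ℕ) : Set where
  constructor exactly
  field
    cofactor     : ℕ
    x≡pᵉcofactor : x ≡ p ^ e * cofactor
    p∤cofactor   : ¬ p ∣ cofactor

^-monoʳ-∣ : ∀ p {e f} → e ≤ f → p ^ e ∣ p ^ f
^-monoʳ-∣ p {e} {f} e≤f = subst (p ^ e ∣_) pᵉpᶠ⁻ᵉ≡pᶠ (m∣m*n (p ^ (f ∸ e)))
  where
  pᵉpᶠ⁻ᵉ≡pᶠ : p ^ e * p ^ (f ∸ e) ≡ p ^ f
  pᵉpᶠ⁻ᵉ≡pᶠ = trans (sym (^-distribˡ-+-* p e (f ∸ e))) (cong (p ^_) (m+[n∸m]≡n e≤f))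

module _ {p : ℕ} (p-prime : Prime p) where

  private instance
    p-nonTrivial : NonTrivial p
    p-nonTrivial = prime⇒nonTrivial p-prime
    p-nonZero : NonZero p
    p-nonZero = prime⇒nonZero p-prime

  exactPower-valuationWithin : ∀ n {x} .{{_ : NonZero x}} → x ≤ n →
                               ExactPower p (valuationWithin n p x) x
  exactPower-valuationWithin zero    {suc _} ()
  exactPower-valuationWithin (suc n) {x}     x≤1+n with p ∣? x
  ... | no  p∤x = exactly x (sym (*-identityˡ x)) p∤x
  ... | yes p∣x with exactPower-valuationWithin n {{quotient≢0 p∣x}}
                       (m<1+n⇒m≤n (≤-trans (quotient-< p∣x) x≤1+n))
  ...   | exactly u q≡pᵉu p∤u = exactly u x≡p¹⁺ᵉu p∤u
    where
    open ≡-Reasoning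
    e = valuationWithin n p (quotient p∣x)
    x≡p¹⁺ᵉu : x ≡ p ^ suc e * u
    x≡p¹⁺ᵉu = begin
      x                  ≡⟨ m∣n⇒n≡m*quotient p∣x ⟩
      p * quotient p∣x   ≡⟨ cong (p *_) q≡pᵉu ⟩
      p * (p ^ e * u)    ≡⟨ *-assoc p (p ^ e) u ⟨
      p ^ suc e * u      ∎

  exactPower-valuation : ∀ x .{{_ : NonZero x}} → ExactPower p (valuation p x) x
  exactPower-valuation x = exactPower-valuationWithin x ≤-refl

  ^∣-exactPower⇒≤ : ∀ {x e} d → ExactPower p e x → p ^ d ∣ x → d ≤ e
  ^∣-exactPower⇒≤ zero                _                   _ = z≤n
  ^∣-exactPower⇒≤ {e = zero}  (suc d) (exactly u refl p∤u) pᵈ⁺¹∣u =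
    contradiction (∣-trans (m∣m*n (p ^ d)) (subst (p * p ^ d ∣_) (*-identityˡ u) pᵈ⁺¹∣u)) p∤u
  ^∣-exactPower⇒≤ {e = suc e} (suc d) (exactly u refl p∤u) pᵈ⁺¹∣pᵉ⁺¹u =
    s≤s (^∣-exactPower⇒≤ d (exactly u refl p∤u)
      (*-cancelˡ-∣ p (subst (p * p ^ d ∣_) (*-assoc p (p ^ e) u) pᵈ⁺¹∣pᵉ⁺¹u)))

  exactPower-unique : ∀ {x e e′} → ExactPower p e x → ExactPower p e′ x → e ≡ e′
  exactPower-unique {e = e} {e′} pᵉ∥x@(exactly u x≡pᵉu _) pᵉ′∥x@(exactly u′ x≡pᵉ′u′ _) =
    ≤-antisym (^∣-exactPower⇒≤ e  pᵉ′∥x (subst (p ^ e ∣_)  (sym x≡pᵉu)   (m∣m*n u)))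
              (^∣-exactPower⇒≤ e′ pᵉ∥x  (subst (p ^ e′ ∣_) (sym x≡pᵉ′u′) (m∣m*n u′)))

  exactPower-* : ∀ {x y e e′} → ExactPower p e x → ExactPower p e′ y →
                 ExactPower p (e + e′) (x * y)
  exactPower-* {e = e} {e′} (exactly u refl p∤u) (exactly u′ refl p∤u′) = exactly (u * u′)
    (trans ([m*n]*[o*p]≡[m*o]*[n*p] (p ^ e) u (p ^ e′) u′)
           (cong (_* (u * u′)) (sym (^-distribˡ-+-* p e e′))))
    (λ p∣uu′ → [ p∤u , p∤u′ ]′ (euclidsLemma u u′ p-prime p∣uu′))

  valuation-exact : ∀ {x e} .{{_ : NonZero x}} → ExactPower p e x → valuation p x ≡ e
  valuation-exact {x} = exactPower-unique (exactPower-valuation x)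

  valuation-1 : valuation p 1 ≡ 0
  valuation-1 = valuation-exact (exactly 1 refl (λ p∣1 → nonTrivial⇒≢1 (∣1⇒≡1 p∣1)))

  valuation-* : ∀ x y .{{_ : NonZero x}} .{{_ : NonZero y}} →
                valuation p (x * y) ≡ valuation p x + valuation p y
  valuation-* x y = valuation-exact {{m*n≢0 x y}}
    (exactPower-* (exactPower-valuation x) (exactPower-valuation y))

  ^∣⇒≤valuation : ∀ {x e} .{{_ : NonZero x}} → p ^ e ∣ x → e ≤ valuation p x
  ^∣⇒≤valuation {x} {e} = ^∣-exactPower⇒≤ e (exactPower-valuation x)

  ≤valuation⇒^∣ : ∀ {x e} .{{_ : NonZero x}} → e ≤ valuation p x → p ^ e ∣ x
  ≤valuation⇒^∣ {x} {e} e≤v with exactPower-valuation x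
  ... | exactly u x≡pᵛu _ = subst (p ^ e ∣_) (sym x≡pᵛu) (∣m⇒∣m*n u (^-monoʳ-∣ p e≤v))

  valuation-mono-∣ : ∀ {x y} .{{_ : NonZero x}} .{{_ : NonZero y}} → x ∣ y →
                     valuation p x ≤ valuation p y
  valuation-mono-∣ x∣y = ^∣⇒≤valuation (∣-trans (≤valuation⇒^∣ ≤-refl) x∣y)

  valuation-gcd : ∀ x y .{{_ : NonZero x}} .{{_ : NonZero y}} →
                  valuation p (gcd x y) ≡ valuation p x ⊓ valuation p y
  valuation-gcd x y = ≤-antisym
    (⊓-glb (valuation-mono-∣ (gcd[m,n]∣m x y)) (valuation-mono-∣ (gcd[m,n]∣n x y)))
    (^∣⇒≤valuation (gcd-greatest (≤valuation⇒^∣ (m⊓n≤m (valuation p x) (valuation p y)))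
                                 (≤valuation⇒^∣ (m⊓n≤n (valuation p x) (valuation p y)))))
    where
    instance
      gcd≢0 : NonZero (gcd x y)
      gcd≢0 = ≢-nonZero (gcd[m,n]≢0 x y (inj₁ (≢-nonZero⁻¹ x)))

∃-primeFactor : ∀ {n} .{{_ : NonZero n}} → n ≢ 1 → ∃[ p ] Prime p × p ∣ n
∃-primeFactor {n} n≢1 with factorise n
... | record { factors = [] ; isFactorisation = n≡1 } = contradiction n≡1 n≢1
... | record { factors = p ∷ _ ; isFactorisation = n≡p*rest ; factorsPrime = p-prime ∷ _ } =
  p , p-prime , subst (p ∣_) (sym n≡p*rest) (m∣m*n _)

valuations≡0⇒≡1 : ∀ {n} .{{_ : NonZero n}} → (∀ {p} → Prime p → valuation p n ≡ 0) → n ≡ 1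
valuations≡0⇒≡1 {n} v≡0 with n ≟ 1
... | yes n≡1 = n≡1
... | no  n≢1 with ∃-primeFactor n≢1
...   | p , p-prime , p∣n = contradiction (subst (1 ≤_) (v≡0 p-prime) 1≤v) λ ()
  where
  1≤v : 1 ≤ valuation p n
  1≤v = ^∣⇒≤valuation p-prime (subst (_∣ n) (sym (*-identityʳ p)) p∣n)

-- Writing x = q · gcd x y, the hypothesis forces every valuation of q to vanish.
∣-byValuations : ∀ {x y} .{{_ : NonZero x}} .{{_ : NonZero y}} →
                 (∀ {p} → Prime p → valuation p x ≤ valuation p y) → x ∣ y
∣-byValuations {x} {y} v≤ = subst (_∣ y) gcd≡x (gcd[m,n]∣n x y)
  where
  open ≡-Reasoning
  d = gcd x y
  d∣x = gcd[m,n]∣m x y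
  q = quotient d∣x
  instance
    d≢0 : NonZero d
    d≢0 = ≢-nonZero (gcd[m,n]≢0 x y (inj₁ (≢-nonZero⁻¹ x)))
    q≢0 : NonZero q
    q≢0 = quotient≢0 d∣x
  x≡qd : x ≡ q * d
  x≡qd = m∣n⇒n≡quotient*m d∣x
  v[q]≡0 : ∀ {p} → Prime p → valuation p q ≡ 0
  v[q]≡0 {p} p-prime = +-cancelʳ-≡ (valuation p d) (valuation p q) 0 (begin
    valuation p q + valuation p d   ≡⟨ valuation-* p-prime q d ⟨
    valuation p (q * d)             ≡⟨ cong (valuation p) x≡qd ⟨
    valuation p x                   ≡⟨ m≤n⇒m⊓n≡m (v≤ p-prime) ⟨
    valuation p x ⊓ valuation p y   ≡⟨ valuation-gcd p-prime x y ⟨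
    valuation p d                   ∎)
  gcd≡x : d ≡ x
  gcd≡x = begin
    d       ≡⟨ *-identityˡ d ⟨
    1 * d   ≡⟨ cong (_* d) (valuations≡0⇒≡1 {q} v[q]≡0) ⟨
    q * d   ≡⟨ x≡qd ⟨
    x       ∎

∈-oneTo⁺ : ∀ {j N} → 1 ≤ j → j ≤ N → j ∈ oneTo N
∈-oneTo⁺ {suc i} _ j≤N = ∈-map⁺ suc (∈-upTo⁺ j≤N)

∈-oneTo⁻ : ∀ {j N} → j ∈ oneTo N → 1 ≤ j × j ≤ N
∈-oneTo⁻ j∈ with ∈-map⁻ suc j∈
... | i , i∈ , refl = z<s , ∈-upTo⁻ i∈

∣lcmList-map : ∀ (f : ℕ → ℕ) {x xs} → x ∈ xs → f x ∣ lcmList (map f xs)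
∣lcmList-map f {xs = y ∷ ys} (here refl)  = m∣lcm[m,n] (f y) (lcmList (map f ys))
∣lcmList-map f {xs = y ∷ ys} (there x∈ys) =
  ∣-trans (∣lcmList-map f x∈ys) (n∣lcm[m,n] (f y) (lcmList (map f ys)))

lcmList-map-least : ∀ (f : ℕ → ℕ) xs {d} → (∀ {x} → x ∈ xs → f x ∣ d) → lcmList (map f xs) ∣ d
lcmList-map-least f []       _   = 1∣ _
lcmList-map-least f (y ∷ ys) f∣d =
  lcm-least (f∣d (here refl)) (lcmList-map-least f ys (f∣d ∘ there))

lcm≢0 : ∀ m n .{{_ : NonZero m}} .{{_ : NonZero n}} → NonZero (lcm m n)
lcm≢0 m n = ≢-nonZero λ lcm≡0 → ≢-nonZero⁻¹ (m * n) {{m*n≢0 m n}}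
  (trans (sym (gcd*lcm m n)) (trans (cong (gcd m n *_) lcm≡0) (*-zeroʳ (gcd m n))))

lcmList-map≢0 : ∀ (f : ℕ → ℕ) xs → (∀ {x} → x ∈ xs → NonZero (f x)) →
                NonZero (lcmList (map f xs))
lcmList-map≢0 f []       _   = _
lcmList-map≢0 f (y ∷ ys) f≢0 =
  lcm≢0 (f y) (lcmList (map f ys)) {{f≢0 (here refl)}} {{lcmList-map≢0 f ys (f≢0 ∘ there)}}

module StrongDivisibilitySequence {a : ℕ → ℕ} (sd : IsStrongDivSeq a) where

  a≢0 : ∀ {j} → 1 ≤ j → NonZero (a j)
  a≢0 1≤j = >-nonZero (proj₁ sd _ 1≤j)

  lcm-terms≢0 : ∀ N → NonZero (lcmList (map a (oneTo N)))
  lcm-terms≢0 N = lcmList-map≢0 a (oneTo N) (λ j∈ → a≢0 (proj₁ (∈-oneTo⁻ j∈)))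

  term∣lcm-terms : ∀ {j N} → 1 ≤ j → j ≤ N → a j ∣ lcmList (map a (oneTo N))
  term∣lcm-terms 1≤j j≤N = ∣lcmList-map a (∈-oneTo⁺ 1≤j j≤N)

  private
    F = seqFact a
    B = seqBinom a (proj₁ sd)
    F≢0 : ∀ m → NonZero (F m)
    F≢0 = seqFact-nonZero a (proj₁ sd)
    F*F≢0 : ∀ k m → NonZero (F k * F m)
    F*F≢0 k m = m*n≢0 (F k) (F m) {{F≢0 k}} {{F≢0 m}}

  valuation-seqFact : ∀ {p} → Prime p → ∀ m → valuation p (F m) ≡ partialSum (valuation p ∘ a) m
  valuation-seqFact     p-prime zero    = valuation-1 p-prime
  valuation-seqFact {p} p-prime (suc m) =
    trans (valuation-* p-prime (F m) (a (suc m)) {{F≢0 m}} {{a≢0 z<s}})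
          (cong (_+ valuation p (a (suc m))) (valuation-seqFact p-prime m))

  valuation-seqFact-* : ∀ {p} → Prime p → ∀ k m →
    valuation p (F k * F m) ≡ partialSum (valuation p ∘ a) k + partialSum (valuation p ∘ a) m
  valuation-seqFact-* p-prime k m =
    trans (valuation-* p-prime (F k) (F m) {{F≢0 k}} {{F≢0 m}})
          (cong₂ _+_ (valuation-seqFact p-prime k) (valuation-seqFact p-prime m))

  gcdToMin-valuation : ∀ {p} → Prime p → GcdToMin (valuation p ∘ a)
  gcdToMin-valuation {p} p-prime {suc i} {suc j} _ _ =
    trans (cong (valuation p) (sym (proj₂ sd (suc i) (suc j) z<s z<s)))
          (valuation-gcd p-prime (a (suc i)) (a (suc j)) {{a≢0 z<s}} {{a≢0 z<s}})

  seqFact-*-∣ : ∀ k m → F k * F m ∣ F (k + m)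
  seqFact-*-∣ k m = ∣-byValuations {{F*F≢0 k m}} {{F≢0 (k + m)}} λ p-prime →
    subst₂ _≤_ (sym (valuation-seqFact-* p-prime k m)) (sym (valuation-seqFact p-prime (k + m)))
      (gcdToMin-superadditive (gcdToMin-valuation p-prime) k m)

  seqFact-suc-∣ : ∀ k m L .{{_ : NonZero L}} → (∀ {j} → 1 ≤ j → j ≤ suc (k + m) → a j ∣ L) →
                  F (suc (k + m)) ∣ L * (F k * F m)
  seqFact-suc-∣ k m L a∣L = ∣-byValuations {{F≢0 (suc (k + m))}} λ {p} p-prime → begin
      valuation p (F (suc (k + m)))               ≡⟨ valuation-seqFact p-prime (suc (k + m)) ⟩
      partialSum (valuation p ∘ a) (suc (k + m))  ≤⟨ subadditive (bounds p-prime) ⟩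
      partialSum (valuation p ∘ a) k + partialSum (valuation p ∘ a) m + valuation p L
                                                  ≡⟨ cong (_+ valuation p L) (valuation-seqFact-* p-prime k m) ⟨
      valuation p (F k * F m) + valuation p L     ≡⟨ +-comm _ (valuation p L) ⟩
      valuation p L + valuation p (F k * F m)     ≡⟨ valuation-* p-prime L (F k * F m) ⟨
      valuation p (L * (F k * F m))               ∎
    where
    open ≤-Reasoning
    instance
      FkFm≢0 : NonZero (F k * F m)
      FkFm≢0 = F*F≢0 k m
      LFkFm≢0 : NonZero (L * (F k * F m))
      LFkFm≢0 = m*n≢0 L (F k * F m)
    bounds : ∀ {p} → Prime p → PartialSumBounds (valuation p ∘ a) k m (valuation p L)
    bounds p-prime = gcdToMin-bounds (gcdToMin-valuation p-prime) k m _
      (λ 1≤j j≤ → valuation-mono-∣ p-prime {{a≢0 1≤j}} (a∣L 1≤j j≤))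

  seqBinom-spec : ∀ {n k} → k ≤ n → B n k * (F k * F (n ∸ k)) ≡ F n
  seqBinom-spec {n} {k} k≤n = m/n*n≡m {{F*F≢0 k (n ∸ k)}}
    (subst (λ N → F k * F (n ∸ k) ∣ F N) (m+[n∸m]≡n k≤n) (seqFact-*-∣ k (n ∸ k)))

  seqFact-suc≡seqBinom : ∀ {n k} → k ≤ n → F (suc n) ≡ B n k * a (suc n) * (F k * F (n ∸ k))
  seqFact-suc≡seqBinom {n} {k} k≤n = begin
    F n * a (suc n)                         ≡⟨ cong (_* a (suc n)) (seqBinom-spec k≤n) ⟨
    B n k * (F k * F (n ∸ k)) * a (suc n)   ≡⟨ *-CS.xy∙z≈xz∙y (B n k) _ (a (suc n)) ⟩
    B n k * a (suc n) * (F k * F (n ∸ k))   ∎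
    where open ≡-Reasoning

  a[1+k]∣seqBinom*a[1+n] : ∀ {n k} → k ≤ n → a (suc k) ∣ B n k * a (suc n)
  a[1+k]∣seqBinom*a[1+n] {n} {k} k≤n = *-cancelʳ-∣ (F k * F (n ∸ k)) {{F*F≢0 k (n ∸ k)}}
    (subst₂ _∣_ (*-CS.xy∙z≈y∙xz (F k) (a (suc k)) (F (n ∸ k))) (seqFact-suc≡seqBinom k≤n)
      (subst (λ N → F (suc k) * F (n ∸ k) ∣ F (suc N)) (m+[n∸m]≡n k≤n)
        (seqFact-*-∣ (suc k) (n ∸ k))))

  seqBinom*a[1+n]∣ : ∀ {n k} L .{{_ : NonZero L}} → (∀ {j} → 1 ≤ j → j ≤ suc n → a j ∣ L) →
                     k ≤ n → B n k * a (suc n) ∣ L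
  seqBinom*a[1+n]∣ {n} {k} L a∣L k≤n = *-cancelʳ-∣ (F k * F (n ∸ k)) {{F*F≢0 k (n ∸ k)}}
    (subst (_∣ L * (F k * F (n ∸ k))) (seqFact-suc≡seqBinom k≤n)
      (subst (λ N → (∀ {j} → 1 ≤ j → j ≤ suc N → a j ∣ L) → F (suc N) ∣ L * (F k * F (n ∸ k)))
        (m+[n∸m]≡n k≤n) (seqFact-suc-∣ k (n ∸ k) L) a∣L))

mainTheorem4 : (a : ℕ → ℕ) → (sd : IsStrongDivSeq a) → (n : ℕ) →
    lcmList (map (seqBinom a (proj₁ sd) n) (upTo (suc n)))
      ≡ (lcmList (map a (oneTo (suc n))) / a (suc n))
          {{>-nonZero (proj₁ sd (suc n) (s≤s z≤n))}}
mainTheorem4 a sd n = ∣-antisym binomials∣L/A L/A∣binomials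
  where
  open StrongDivisibilitySequence sd
  B = seqBinom a (proj₁ sd) n
  A = a (suc n)
  L = lcmList (map a (oneTo (suc n)))
  Λ = lcmList (map B (upTo (suc n)))
  instance
    A≢0 : NonZero A
    A≢0 = a≢0 z<s
    L≢0 : NonZero L
    L≢0 = lcm-terms≢0 (suc n)
  binomials∣L/A : Λ ∣ L / A
  binomials∣L/A = lcmList-map-least B (upTo (suc n)) λ {k} k∈ →
    m*n∣o⇒m∣o/n (B k) A (seqBinom*a[1+n]∣ {n} {k} L term∣lcm-terms (m<1+n⇒m≤n (∈-upTo⁻ k∈)))
  a∣Λ*A : ∀ {j} → j ∈ oneTo (suc n) → a j ∣ Λ * A
  a∣Λ*A j∈ with ∈-oneTo⁻ j∈
  ... | s≤s z≤n , s≤s k≤n =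
    ∣-trans (a[1+k]∣seqBinom*a[1+n] k≤n) (*-monoˡ-∣ A (∣lcmList-map B (∈-upTo⁺ (s≤s k≤n))))
  L/A∣binomials : L / A ∣ Λ
  L/A∣binomials =
    m∣n*o⇒m/n∣o (term∣lcm-terms z<s ≤-refl) (lcmList-map-least a (oneTo (suc n)) a∣Λ*A)
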